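{- Let $\mathfrak p_1,\mathfrak p_2\in D_n^A$ have height sequences $(h^{(1)}_1,\dots,h^{(1)}_n)$ and $(h^{(2)}_1,\dots,h^{(2)}_n)$. Then the relative pseudocomplement $\mathfrak p_1\to\mathfrak p_2$ in $\mathcal{D}_n^A$ is the Dyck path $\mathfrak p\in D_n^A$ with height sequence $(h_1,\dots,h_n)$ defined (recursively from the right) by $$h_i=\begin{cases} h_{i+1},& i<n \text{ and } h^{(1)}_i\le h^{(2)}_i,\\ h^{(2)}_i,& i=n, \text{ or } i<n\text{ and } h^{(1)}_i>h^{(2)}_i.\end{cases}$$
   Context: $D_n^A$ is the set of Dyck paths of type $A$ of semilength $n$: words of length $2n$ over $\{u,r\}$ with exactly $n$ $u$'s and $n$ $r$'s such that every prefix has at least as many $u$'s as $r$'s. The height sequence of such a word is $(h_1,\dots,h_n)$, $h_i$ the number of $u$'s preceding the $i$-th $r$; these are exactly the integer sequences with $h_1\le\dots\le h_n$ and $i\le h_i\le n$ for all $i$. $\mathcal{D}_n^A$ is $D_n^A$ ordered componentwise by height sequences (dominance order); it is a distributive lattice with meet/join the componentwise min/max. The relative pseudocomplement $x\to y$ is the greatest $z$ with $x\wedge z\le y$. -}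

module Defs where

open import Data.Nat using (ℕ; zero; suc; _≤_; _⊓_; _≤?_)
open import Data.List using (List; []; _∷_; take; zipWith)
open import Data.List.Relation.Binary.Pointwise using (Pointwise)
open import Data.Product using (_×_)
open import Relation.Nullary using (yes; no)
open import Relation.Binary.PropositionalEquality using (_≡_)

-- Letters of a Dyck word: u (up step) and r (right step).
data Letter : Set where
  u r : Letter

Word : Set
Word = List Letter

#u : Word → ℕ
#u []      = 0
#u (u ∷ w) = suc (#u w)
#u (r ∷ w) = #u w

#r : Word → ℕ
#r []      = 0
#r (u ∷ w) = #r w
#r (r ∷ w) = suc (#r w)

IsDyck : ℕ → Word → Set
IsDyck n w = (#u w ≡ n) × (#r w ≡ n) × (∀ k → #r (take k w) ≤ #u (take k w))

heightsFrom : ℕ → Word → List ℕ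
heightsFrom c []      = []
heightsFrom c (u ∷ w) = heightsFrom (suc c) w
heightsFrom c (r ∷ w) = c ∷ heightsFrom c w

heights : Word → List ℕ
heights = heightsFrom 0

_≼_ : Word → Word → Set
p ≼ q = Pointwise _≤_ (heights p) (heights q)

-- (p ∧ q) ≼ y, where the meet p ∧ q has height sequence the componentwise min.
MeetBelow : Word → Word → Word → Set
MeetBelow p q y = Pointwise _≤_ (zipWith _⊓_ (heights p) (heights q)) (heights y)

IsRelPseudocomplement : ℕ → Word → Word → Word → Set
IsRelPseudocomplement n x y z =
  IsDyck n z × MeetBelow x z y × (∀ w → IsDyck n w → MeetBelow x w y → w ≼ z)

-- The sequence (h_1,…,h_n) of Theorem 3.5, computed recursively from the right
-- from h⁽¹⁾ and h⁽²⁾ (inputs of unequal length never occur for Dyck paths).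
rpcHeights : List ℕ → List ℕ → List ℕ
rpcHeights []       []       = []
rpcHeights (a ∷ as) (b ∷ bs) = step (rpcHeights as bs)
  where
  step : List ℕ → List ℕ
  step []            = b ∷ []
  step (h′ ∷ rest) with a ≤? b
  ... | yes _ = h′ ∷ h′ ∷ rest
  ... | no  _ = b ∷ h′ ∷ rest
rpcHeights _        _        = []

-- The height sequences of D_n^A are exactly the ascending sequences 0 ≤ h₁ ≤ … ≤ hₙ ≤ n
-- with hᵢ ≥ i, and a word is rebuilt from its heights, so the question lives on such lists.
-- The sequence h of the theorem dominates h⁽²⁾ and is ascending, hence is a height sequence;
-- it exceeds h⁽²⁾ only at indices with h⁽¹⁾ᵢ ≤ h⁽²⁾ᵢ, so h⁽¹⁾ ⊓ h ≤ h⁽²⁾. Conversely, for any w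
-- with h⁽¹⁾ ⊓ w ≤ h⁽²⁾: where h⁽¹⁾ᵢ > h⁽²⁾ᵢ this forces wᵢ ≤ h⁽²⁾ᵢ = hᵢ, and elsewhere
-- wᵢ ≤ wᵢ₊₁ ≤ hᵢ₊₁ = hᵢ, the recursion ending at wₙ ≤ n = h⁽²⁾ₙ.

module Submission where

open import Defs
open import Data.Nat using (ℕ; zero; suc; _+_; _∸_; _≤_; _⊓_; _≤?_; z≤n)
open import Data.Nat.Properties
open import Data.List using (List; []; _∷_; take; zipWith; length; replicate; _++_)
open import Data.List.Relation.Binary.Pointwise using (Pointwise; []; _∷_; Pointwise-length)
open import Data.Product using (Σ; _×_; _,_; proj₁; proj₂)
open import Data.Unit using (⊤; tt)
open import Data.Sum using (inj₁; inj₂)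
open import Relation.Nullary using (yes; no; ¬_)
open import Relation.Nullary.Negation using (contradiction)
open import Relation.Binary.PropositionalEquality

Ascending : ℕ → ℕ → List ℕ → Set
Ascending c n []       = c ≤ n
Ascending c n (h ∷ hs) = c ≤ h × Ascending h n hs

AboveDiagonal : ℕ → List ℕ → Set
AboveDiagonal d []       = ⊤
AboveDiagonal d (h ∷ hs) = suc d ≤ h × AboveDiagonal (suc d) hs

EndsAtLeast : ℕ → List ℕ → Set
EndsAtLeast n []           = ⊤
EndsAtLeast n (y ∷ [])     = n ≤ y
EndsAtLeast n (_ ∷ y ∷ ys) = EndsAtLeast n (y ∷ ys)

HeightSequence : ℕ → List ℕ → Set
HeightSequence n hs = length hs ≡ n × Ascending 0 n hs × AboveDiagonal 0 hs

data Ballot : ℕ → ℕ → Word → Set where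
  []  : ∀ {c d} → Ballot c d []
  u∷_ : ∀ {c d w} → Ballot (suc c) d w → Ballot c d (u ∷ w)
  r∷⟨_⟩_ : ∀ {c d w} → suc d ≤ c → Ballot c (suc d) w → Ballot c d (r ∷ w)

ascending-weaken : ∀ {c c′ n} hs → c ≤ c′ → Ascending c′ n hs → Ascending c n hs
ascending-weaken []      c≤c′ c′≤n       = ≤-trans c≤c′ c′≤n
ascending-weaken (_ ∷ _) c≤c′ (c′≤h , a) = ≤-trans c≤c′ c′≤h , a

aboveDiagonal-mono : ∀ d {Y Z} → Pointwise _≤_ Y Z → AboveDiagonal d Y → AboveDiagonal d Z
aboveDiagonal-mono d []         tt        = tt
aboveDiagonal-mono d (y≤z ∷ ps) (d<y , a) = ≤-trans d<y y≤z , aboveDiagonal-mono (suc d) ps a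

aboveDiagonal⇒endsAtLeast : ∀ {n} d Y → AboveDiagonal d Y → d + length Y ≡ n → EndsAtLeast n Y
aboveDiagonal⇒endsAtLeast d []           _         _  = tt
aboveDiagonal⇒endsAtLeast d (y ∷ [])     (d<y , _) eq =
  subst (_≤ y) (trans (sym (+-comm d 1)) eq) d<y
aboveDiagonal⇒endsAtLeast d (_ ∷ y ∷ ys) (_ , a)   eq =
  aboveDiagonal⇒endsAtLeast (suc d) (y ∷ ys) a (trans (sym (+-suc d _)) eq)

heightSequence⇒endsAtLeast : ∀ {n Y} → HeightSequence n Y → EndsAtLeast n Y
heightSequence⇒endsAtLeast {Y = Y} (len , _ , above) = aboveDiagonal⇒endsAtLeast 0 Y above len

length-heightsFrom : ∀ c w → length (heightsFrom c w) ≡ #r w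
length-heightsFrom c []      = refl
length-heightsFrom c (u ∷ w) = length-heightsFrom (suc c) w
length-heightsFrom c (r ∷ w) = cong suc (length-heightsFrom c w)

heightsFrom-ascending : ∀ c w → Ascending c (c + #u w) (heightsFrom c w)
heightsFrom-ascending c []      = m≤m+n c 0
heightsFrom-ascending c (u ∷ w) rewrite +-suc c (#u w) =
  ascending-weaken (heightsFrom (suc c) w) (n≤1+n c) (heightsFrom-ascending (suc c) w)
heightsFrom-ascending c (r ∷ w) = ≤-refl , heightsFrom-ascending c w

prefixes⇒ballot : ∀ c d w → (∀ k → d + #r (take k w) ≤ c + #u (take k w)) → Ballot c d w
prefixes⇒ballot c d []      _ = []
prefixes⇒ballot c d (u ∷ w) H =
  u∷ prefixes⇒ballot (suc c) d w λ k → subst (d + #r (take k w) ≤_) (+-suc c _) (H (suc k))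
prefixes⇒ballot c d (r ∷ w) H =
  r∷⟨ subst₂ _≤_ (+-comm d 1) (+-identityʳ c) (H 1) ⟩
    prefixes⇒ballot c (suc d) w λ k → subst (_≤ c + #u (take k w)) (+-suc d _) (H (suc k))

ballot⇒prefixes : ∀ {c d w} → d ≤ c → Ballot c d w → ∀ k → d + #r (take k w) ≤ c + #u (take k w)
ballot⇒prefixes d≤c _  zero    = +-monoˡ-≤ 0 d≤c
ballot⇒prefixes d≤c [] (suc k) = +-monoˡ-≤ 0 d≤c
ballot⇒prefixes {c} {d} {u ∷ w} d≤c (u∷ b) (suc k) =
  subst (d + #r (take k w) ≤_) (sym (+-suc c _)) (ballot⇒prefixes (m≤n⇒m≤1+n d≤c) b k)
ballot⇒prefixes {c} {d} {r ∷ w} d≤c (r∷⟨ d<c ⟩ b) (suc k) =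
  subst (_≤ c + #u (take k w)) (sym (+-suc d _)) (ballot⇒prefixes d<c b k)

ballot⇒aboveDiagonal : ∀ {c d w} → Ballot c d w → AboveDiagonal d (heightsFrom c w)
ballot⇒aboveDiagonal []           = tt
ballot⇒aboveDiagonal (u∷ b)       = ballot⇒aboveDiagonal b
ballot⇒aboveDiagonal (r∷⟨ d<c ⟩ b) = d<c , ballot⇒aboveDiagonal b

heights-heightSequence : ∀ {n w} → IsDyck n w → HeightSequence n (heights w)
heights-heightSequence {n} {w} (#u≡n , #r≡n , prefixes) =
  trans (length-heightsFrom 0 w) #r≡n ,
  subst (λ m → Ascending 0 m (heights w)) #u≡n (heightsFrom-ascending 0 w) ,
  ballot⇒aboveDiagonal (prefixes⇒ballot 0 0 w prefixes)

heights-sameLength : ∀ {n v w} → IsDyck n v → IsDyck n w → length (heights v) ≡ length (heights w)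
heights-sameLength dyck-v dyck-w =
  trans (proj₁ (heights-heightSequence dyck-v)) (sym (proj₁ (heights-heightSequence dyck-w)))

fromHeights : ℕ → ℕ → List ℕ → Word
fromHeights n c []       = replicate (n ∸ c) u ++ []
fromHeights n c (h ∷ hs) = replicate (h ∸ c) u ++ r ∷ fromHeights n h hs

heightsFrom-ups : ∀ m c w → heightsFrom c (replicate m u ++ w) ≡ heightsFrom (m + c) w
heightsFrom-ups zero    c w = refl
heightsFrom-ups (suc m) c w = trans (heightsFrom-ups m (suc c) w) (cong (λ k → heightsFrom k w) (+-suc m c))

#r-ups : ∀ m w → #r (replicate m u ++ w) ≡ #r w
#r-ups zero    w = refl
#r-ups (suc m) w = #r-ups m w

#u-ups : ∀ m w → #u (replicate m u ++ w) ≡ m + #u w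
#u-ups zero    w = refl
#u-ups (suc m) w = cong suc (#u-ups m w)

ballot-ups : ∀ m {c d w} → Ballot (m + c) d w → Ballot c d (replicate m u ++ w)
ballot-ups zero    b = b
ballot-ups (suc m) {c} {d} {w} b = u∷ ballot-ups m (subst (λ k → Ballot k d w) (sym (+-suc m c)) b)

module _ {c h : ℕ} (c≤h : c ≤ h) where

  heightsFrom-ups-to : ∀ w → heightsFrom c (replicate (h ∸ c) u ++ w) ≡ heightsFrom h w
  heightsFrom-ups-to w = trans (heightsFrom-ups (h ∸ c) c w) (cong (λ k → heightsFrom k w) (m∸n+n≡m c≤h))

  #u-ups-to : ∀ w → c + #u (replicate (h ∸ c) u ++ w) ≡ h + #u w
  #u-ups-to w = begin
    c + #u (replicate (h ∸ c) u ++ w) ≡⟨ cong (c +_) (#u-ups (h ∸ c) w) ⟩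
    c + (h ∸ c + #u w)                ≡⟨ +-assoc c (h ∸ c) (#u w) ⟨
    c + (h ∸ c) + #u w                ≡⟨ cong (_+ #u w) (m+[n∸m]≡n c≤h) ⟩
    h + #u w                          ∎
    where open ≡-Reasoning

  ballot-ups-to : ∀ {d w} → Ballot h d w → Ballot c d (replicate (h ∸ c) u ++ w)
  ballot-ups-to {d} {w} b = ballot-ups (h ∸ c) (subst (λ k → Ballot k d w) (sym (m∸n+n≡m c≤h)) b)

heightsFrom-fromHeights : ∀ n c hs → Ascending c n hs → heightsFrom c (fromHeights n c hs) ≡ hs
heightsFrom-fromHeights n c []       c≤n      = heightsFrom-ups-to c≤n []
heightsFrom-fromHeights n c (h ∷ hs) (c≤h , a) =
  trans (heightsFrom-ups-to c≤h _) (cong (h ∷_) (heightsFrom-fromHeights n h hs a))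

#r-fromHeights : ∀ n c hs → #r (fromHeights n c hs) ≡ length hs
#r-fromHeights n c []       = #r-ups (n ∸ c) []
#r-fromHeights n c (h ∷ hs) = trans (#r-ups (h ∸ c) _) (cong suc (#r-fromHeights n h hs))

#u-fromHeights : ∀ n c hs → Ascending c n hs → c + #u (fromHeights n c hs) ≡ n
#u-fromHeights n c []       c≤n      = trans (#u-ups-to c≤n []) (+-identityʳ n)
#u-fromHeights n c (h ∷ hs) (c≤h , a) = trans (#u-ups-to c≤h _) (#u-fromHeights n h hs a)

fromHeights-ballot : ∀ n c d hs → Ascending c n hs → AboveDiagonal d hs → Ballot c d (fromHeights n c hs)
fromHeights-ballot n c d []       c≤n       _          = ballot-ups-to c≤n []
fromHeights-ballot n c d (h ∷ hs) (c≤h , a) (d<h , ad) =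
  ballot-ups-to c≤h (r∷⟨ d<h ⟩ fromHeights-ballot n h (suc d) hs a ad)

fromHeights-dyck : ∀ {n hs} → HeightSequence n hs → IsDyck n (fromHeights n 0 hs)
fromHeights-dyck {n} {hs} (len , a , ad) =
  #u-fromHeights n 0 hs a ,
  trans (#r-fromHeights n 0 hs) len ,
  ballot⇒prefixes z≤n (fromHeights-ballot n 0 0 hs a ad)

rpcHeights-ascending : ∀ {c n} X Y → length X ≡ length Y → Ascending c n Y → Ascending c n (rpcHeights X Y)
rpcHeights-ascending []       []       _  a          = a
rpcHeights-ascending (a ∷ as) (b ∷ bs) eq (c≤b , asc)
  with rpcHeights as bs | rpcHeights-ascending as bs (suc-injective eq) asc
... | []    | b≤n       = c≤b , b≤n
... | h ∷ t | b≤h , a′ with a ≤? b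
...   | yes _ = ≤-trans c≤b b≤h , ≤-refl , a′
...   | no  _ = c≤b , b≤h , a′

≤-rpcHeights : ∀ {c n} X Y → length X ≡ length Y → Ascending c n Y → Pointwise _≤_ Y (rpcHeights X Y)
≤-rpcHeights []       []       _  _         = []
≤-rpcHeights (a ∷ as) (b ∷ bs) eq (_ , asc)
  with rpcHeights as bs | rpcHeights-ascending as bs (suc-injective eq) asc
     | ≤-rpcHeights as bs (suc-injective eq) asc
... | []    | _       | ps = ≤-refl ∷ ps
... | h ∷ t | b≤h , _ | ps with a ≤? b
...   | yes _ = b≤h ∷ ps
...   | no  _ = ≤-refl ∷ ps

rpcHeights-heightSequence : ∀ {n} X Y → length X ≡ n → HeightSequence n Y → HeightSequence n (rpcHeights X Y)
rpcHeights-heightSequence X Y lenX (lenY , a , ad) =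
  trans (sym (Pointwise-length Y≤Z)) lenY ,
  rpcHeights-ascending X Y lenX≡lenY a ,
  aboveDiagonal-mono 0 Y≤Z ad
  where
  lenX≡lenY = trans lenX (sym lenY)
  Y≤Z = ≤-rpcHeights X Y lenX≡lenY a

rpcHeights-meet : ∀ X Y → length X ≡ length Y → Pointwise _≤_ (zipWith _⊓_ X (rpcHeights X Y)) Y
rpcHeights-meet []       []       _  = []
rpcHeights-meet (a ∷ as) (b ∷ bs) eq with rpcHeights as bs | rpcHeights-meet as bs (suc-injective eq)
... | []    | ps = m⊓n≤n a b ∷ ps
... | h ∷ _ | ps with a ≤? b
...   | yes a≤b = ≤-trans (m⊓n≤m a h) a≤b ∷ ps
...   | no  _   = m⊓n≤n a b ∷ ps

⊓-≤-≰ : ∀ {a w b} → a ⊓ w ≤ b → ¬ (a ≤ b) → w ≤ b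
⊓-≤-≰ {a} {w} {b} a⊓w≤b a≰b with ≤-total a w
... | inj₁ a≤w = contradiction (subst (_≤ b) (m≤n⇒m⊓n≡m a≤w) a⊓w≤b) a≰b
... | inj₂ w≤a = subst (_≤ b) (m≥n⇒m⊓n≡n w≤a) a⊓w≤b

rpcHeights-greatest : ∀ {c n} X Y W → length X ≡ length Y → length W ≡ length Y →
                      Ascending c n W → EndsAtLeast n Y →
                      Pointwise _≤_ (zipWith _⊓_ X W) Y → Pointwise _≤_ W (rpcHeights X Y)
rpcHeights-greatest []       []       []       _ _ _ _ [] = []
rpcHeights-greatest (a ∷ []) (b ∷ []) (w ∷ []) _ _ (_ , w≤n) n≤b (p ∷ []) with a ≤? b
... | yes _   = ≤-trans w≤n n≤b ∷ []
... | no  a≰b = ⊓-≤-≰ p a≰b ∷ []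
rpcHeights-greatest (a ∷ a′ ∷ as) (b ∷ b′ ∷ bs) (w ∷ w′ ∷ ws) eqX eqW (_ , w≤w′ , asc) end (p ∷ ps)
  with rpcHeights (a′ ∷ as) (b′ ∷ bs)
     | rpcHeights-greatest (a′ ∷ as) (b′ ∷ bs) (w′ ∷ ws)
         (suc-injective eqX) (suc-injective eqW) (w≤w′ , asc) end ps
... | h ∷ t | w′≤h ∷ qs with a ≤? b
...   | yes _   = ≤-trans w≤w′ w′≤h ∷ w′≤h ∷ qs
...   | no  a≰b = ⊓-≤-≰ p a≰b ∷ w′≤h ∷ qs
rpcHeights-greatest (_ ∷ [])    (_ ∷ _ ∷ _) _           () _  _ _ _
rpcHeights-greatest (_ ∷ _ ∷ _) (_ ∷ [])    _           () _  _ _ _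
rpcHeights-greatest []          []          (_ ∷ _)     _  () _ _ _
rpcHeights-greatest (_ ∷ [])    (_ ∷ [])    (_ ∷ _ ∷ _) _  () _ _ _
rpcHeights-greatest (_ ∷ _ ∷ _) (_ ∷ _ ∷ _) (_ ∷ [])    _  () _ _ _

theorem3p5 : (n : ℕ) (p₁ p₂ : Word) → IsDyck n p₁ → IsDyck n p₂ →
    Σ Word (λ p → heights p ≡ rpcHeights (heights p₁) (heights p₂)
                  × IsRelPseudocomplement n p₁ p₂ p)
theorem3p5 n p₁ p₂ dyck₁ dyck₂ =
  p , heights-p , fromHeights-dyck Z-seq , meet , greatest
  where
  X = heights p₁
  Y = heights p₂
  Z = rpcHeights X Y
  Y-seq : HeightSequence n Y
  Y-seq = heights-heightSequence dyck₂
  Z-seq : HeightSequence n Z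
  Z-seq = rpcHeights-heightSequence X Y (proj₁ (heights-heightSequence dyck₁)) Y-seq
  p : Word
  p = fromHeights n 0 Z
  heights-p : heights p ≡ Z
  heights-p = heightsFrom-fromHeights n 0 Z (proj₁ (proj₂ Z-seq))
  meet : MeetBelow p₁ p p₂
  meet rewrite heights-p = rpcHeights-meet X Y (heights-sameLength dyck₁ dyck₂)
  greatest : ∀ w → IsDyck n w → MeetBelow p₁ w p₂ → w ≼ p
  greatest w dyck meetBelow rewrite heights-p =
    rpcHeights-greatest X Y (heights w) (heights-sameLength dyck₁ dyck₂) (heights-sameLength dyck dyck₂)
      (proj₁ (proj₂ (heights-heightSequence dyck))) (heightSequence⇒endsAtLeast Y-seq) meetBelow
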